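{- Let $(\mathcal{V},\mathcal{B})$ be a $2$-$(v,k,1)$ design. If $(\mathcal{V},\mathcal{B})$ has a $2$-$(w,k,1)$ subdesign with $v<kw$ and $w^2-w<k(v-1)$, then $(\mathcal{V},\mathcal{B})$ does not have the MMS star property.
   Context: A $2$-$(v,k,1)$ design is a pair $(\mathcal{V},\mathcal{B})$ with $|\mathcal{V}|=v$ and $\mathcal{B}$ a family of $k$-subsets (blocks) of $\mathcal{V}$ such that every pair of distinct elements of $\mathcal{V}$ lies in exactly one block; each element lies in exactly $\frac{v-1}{k-1}$ blocks. A $2$-$(w,k,1)$ subdesign is a $2$-$(w,k,1)$ design $(\mathcal{V}',\mathcal{B}')$ with $\mathcal{V}'\subseteq\mathcal{V}$, $|\mathcal{V}'|=w$, $\mathcal{B}'\subseteq\mathcal{B}$. The design has the MMS star property if for every $f:\mathcal{V}\to\mathbb{R}$ with $\sum_{x\in\mathcal{V}}f(x)=0$, the number of blocks $B$ with $\sum_{x\in B}f(x)\ge 0$ is at least $\frac{v-1}{k-1}$. -}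

module Defs where

open import Data.Nat using (ℕ; _≤_; _*_; _∸_)
open import Data.Fin using (Fin)
open import Data.Fin.Subset using (Subset; _∈_; _⊆_; ∣_∣)
open import Data.Fin.Subset.Properties using (_∈?_)
open import Data.List using (List; length; filter; map; foldr; allFin)
open import Data.List.Relation.Unary.All using (All)
open import Data.List.Relation.Binary.Sublist.Propositional using ()
  renaming (_⊆_ to _⊑_)
open import Data.Product using (Σ; _×_)
open import Data.Rational using (ℚ; 0ℚ; _+_; _≤?_) renaming (_≤_ to _≤ℚ_)
open import Relation.Nullary.Decidable using (_×-dec_)
open import Relation.Binary.PropositionalEquality using (_≡_; _≢_)

-- Points are Fin v; a block is a subset of Fin v; the block family is a list.

pairCount : {v : ℕ} → List (Subset v) → Fin v → Fin v → ℕ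
pairCount Bs x y = length (filter (λ B → (x ∈? B) ×-dec (y ∈? B)) Bs)

IsDesign : (v k : ℕ) → List (Subset v) → Set
IsDesign v k Bs =
  All (λ B → ∣ B ∣ ≡ k) Bs ×
  (∀ (x y : Fin v) → x ≢ y → pairCount Bs x y ≡ 1)

HasSubdesign : (v k w : ℕ) → List (Subset v) → Set
HasSubdesign v k w Bs =
  Σ (Subset v) λ W → ∣ W ∣ ≡ w ×
  Σ (List (Subset v)) λ Bs' → Bs' ⊑ Bs ×
    All (λ B → B ⊆ W) Bs' ×
    All (λ B → ∣ B ∣ ≡ k) Bs' ×
    (∀ (x y : Fin v) → x ∈ W → y ∈ W → x ≢ y → pairCount Bs' x y ≡ 1)

sumℚ : List ℚ → ℚ
sumℚ = foldr _+_ 0ℚ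

totalSum : {v : ℕ} → (Fin v → ℚ) → ℚ
totalSum f = sumℚ (map f (allFin _))

blockSum : {v : ℕ} → (Fin v → ℚ) → Subset v → ℚ
blockSum f B = sumℚ (map f (filter (_∈? B) (allFin _)))

nonnegBlocks : {v : ℕ} → (Fin v → ℚ) → List (Subset v) → ℕ
nonnegBlocks f Bs = length (filter (λ B → 0ℚ ≤? blockSum f B) Bs)

-- MMS star property: #nonneg blocks ≥ (v-1)/(k-1), written as
-- (v-1) ≤ #nonneg * (k-1) (equivalent for k ≥ 2).
MMSStar : (v k : ℕ) → List (Subset v) → Set
MMSStar v k Bs =
  ∀ (f : Fin v → ℚ) → totalSum f ≡ 0ℚ → v ∸ 1 ≤ nonnegBlocks f Bs * (k ∸ 1)

module Submission where

-- Let W be the point set of the subdesign, w = |W|, and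
-- consider the test function f = v·[x ∈ W] − w, whose total sum is
-- w·v − v·w = 0.  A block B has block sum |B ∩ W|·v − k·w, so if it is
-- non-negative then |B ∩ W|·v ≥ k·w > v and B meets W in two distinct
-- points; the subdesign block through those two points is then B itself,
-- so B ⊆ W.  Hence the non-negative blocks form a family N of k-subsets of W
-- in which any two points lie together in at most one block.  A packing
-- count (through a point x ∈ W the blocks of N are disjoint outside x, so at
-- most (w−1)/(k−1) of them contain x) gives |N|·k·(k−1) ≤ w·(w−1).  The MMS
-- star property would give v − 1 ≤ |N|·(k−1), hence k·(v−1) ≤ w² − w,
-- contradicting the hypothesis.

open import Defs
open import Data.Bool using (true; false)
open import Data.Empty using (⊥-elim)
open import Data.Fin as Fin using (Fin; zero; suc)
open import Data.Fin.Subset using (Subset; inside; outside; ∣_∣; ⁅_⁆)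
  renaming (_∈_ to _∈ₛ_; _⊆_ to _⊆ₛ_)
open import Data.Fin.Subset.Properties using (_∈?_; x∈⁅x⁆; x∈⁅y⁆⇒x≡y; ∣⁅x⁆∣≡1)
import Data.Vec as Vec
open import Data.Integer as ℤ using (ℤ)
import Data.Integer.Properties as ℤ
open import Data.Integer.Tactic.RingSolver using (solve-∀)
open import Data.List using (List; []; _∷_; length; filter; map; foldr; tabulate; allFin)
open import Data.List.Membership.Propositional using (_∈_)
open import Data.List.Membership.Propositional.Properties using (∈-filter⁻; ∈-filter⁺)
open import Data.List.Properties using (length-filter; filter-≐; length-tabulate)
open import Data.List.Relation.Binary.Sublist.Propositional using () renaming (_⊆_ to _⊑_)
open import Data.List.Relation.Binary.Sublist.Propositional.Properties
  using (Any-resp-⊆; filter⁺; filter-⊆; length-mono-≤)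
open import Data.List.Relation.Unary.All as All using (All; _∷_)
open import Data.List.Relation.Unary.Any using (here; there)
open import Data.List.Relation.Unary.Unique.Propositional using (Unique; _∷_)
import Data.List.Relation.Unary.Unique.Propositional.Properties as Unique
open import Data.Nat using (ℕ; zero; suc; _+_; _*_; _∸_; _≤_; _<_; z≤n; s≤s)
open import Data.Nat.ListAction using (sum)
open import Data.Nat.Properties
open import Algebra.Properties.CommutativeSemigroup +-commutativeSemigroup
  using () renaming (x∙yz≈y∙xz to +-exchange)
open import Data.Product using (Σ; ∃₂; _×_; _,_; proj₁; proj₂)
open import Data.Rational using (ℚ; mkℚ; 0ℚ) renaming (_+_ to _+ℚ_; _≤_ to _≤ℚ_; _≤?_ to _≤ℚ?_)
import Data.Rational as ℚ
open import Data.Rational.Properties using (toℚᵘ-injective; toℚᵘ-homo-+)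
import Data.Rational.Unnormalised as ℚᵘ
import Data.Rational.Unnormalised.Properties as ℚᵘ
open import Data.Nat.Coprimality using (1-coprimeTo) renaming (sym to coprime-sym)
open import Function using (_∘_)
open import Relation.Binary.Definitions using (DecidableEquality)
open import Relation.Binary.PropositionalEquality
open import Relation.Nullary using (¬_; Dec; yes; no; does)
open import Relation.Nullary.Decidable using (_×-dec_)
open import Relation.Unary using (Pred; Decidable) renaming (_⊆_ to _⇒_)
open import Relation.Unary.Properties using (∁?)

count : ∀ {a p} {A : Set a} {P : Pred A p} → Decidable P → List A → ℕ
count P? xs = length (filter P? xs)

module _ {a p q} {A : Set a} {P : Pred A p} {Q : Pred A q}
         (P? : Decidable P) (Q? : Decidable Q) where

  filter-filter : ∀ xs → filter Q? (filter P? xs) ≡ filter (λ x → P? x ×-dec Q? x) xs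
  filter-filter [] = refl
  filter-filter (x ∷ xs) with P? x
  ... | no _ = filter-filter xs
  ... | yes _ with Q? x
  ...   | yes _ = cong (x ∷_) (filter-filter xs)
  ...   | no _  = filter-filter xs

module _ {a p q} {A : Set a} {P : Pred A p} {Q : Pred A q}
         (P? : Decidable P) (Q? : Decidable Q) where

  count-within : P ⇒ Q → ∀ xs → count P? (filter Q? xs) ≡ count P? xs
  count-within P⇒Q xs = cong length (begin
    filter P? (filter Q? xs)                ≡⟨ filter-filter Q? P? xs ⟩
    filter (λ x → Q? x ×-dec P? x) xs       ≡⟨ filter-≐ _ P? ((λ qp → proj₂ qp) , λ px → P⇒Q px , px) xs ⟩
    filter P? xs                            ∎)
    where open ≡-Reasoning

module _ {a p} {A : Set a} {P : Pred A p} (P? : Decidable P) where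

  count-partition : ∀ xs → count P? xs + count (∁? P?) xs ≡ length xs
  count-partition [] = refl
  count-partition (x ∷ xs) with P? x
  ... | yes _ = cong suc (count-partition xs)
  ... | no _  = trans (+-suc _ _) (cong suc (count-partition xs))

module _ {a} {A : Set a} where

  sum-const : (h : A → ℕ) {c : ℕ} (xs : List A) →
              (∀ {x} → x ∈ xs → h x ≡ c) → sum (map h xs) ≡ length xs * c
  sum-const h [] _ = refl
  sum-const h (x ∷ xs) h≡c = cong₂ _+_ (h≡c (here refl)) (sum-const h xs (h≡c ∘ there))

  sum-bound : (h : A → ℕ) (c d : ℕ) (xs : List A) →
              (∀ {x} → x ∈ xs → h x * c ≤ d) → sum (map h xs) * c ≤ length xs * d
  sum-bound h c d [] _ = z≤n
  sum-bound h c d (x ∷ xs) bound = begin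
    (h x + sum (map h xs)) * c       ≡⟨ *-distribʳ-+ c (h x) _ ⟩
    h x * c + sum (map h xs) * c     ≤⟨ +-mono-≤ (bound (here refl)) (sum-bound h c d xs (bound ∘ there)) ⟩
    d + length xs * d                ∎
    where open ≤-Reasoning

module _ {a} {A : Set a} (_≟_ : DecidableEquality A) where

  sum-peak-bound : (h : A → ℕ) (x : A) {c : ℕ} → h x ≤ c → (∀ {y} → y ≢ x → h y ≤ 1) →
                   ∀ xs → sum (map h xs) ≤ count (_≟ x) xs * c + count (∁? (_≟ x)) xs
  sum-peak-bound h x hx≤c hy≤1 [] = z≤n
  sum-peak-bound h x {c} hx≤c hy≤1 (y ∷ ys) with y ≟ x
  ... | yes refl = ≤-trans (+-mono-≤ hx≤c (sum-peak-bound h x hx≤c hy≤1 ys))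
                           (≤-reflexive (sym (+-assoc c _ _)))
  ... | no y≢x   = ≤-trans (+-mono-≤ (hy≤1 y≢x) (sum-peak-bound h x hx≤c hy≤1 ys))
                           (≤-reflexive (sym (+-suc _ _)))

module _ {a b r} {A : Set a} {B : Set b} {R : A → B → Set r}
         (R? : ∀ x y → Dec (R x y)) where

  sum-count-cons : ∀ y Y X →
    sum (map (λ x → count (R? x) (y ∷ Y)) X) ≡ count (λ x → R? x y) X + sum (map (λ x → count (R? x) Y) X)
  sum-count-cons y Y [] = refl
  sum-count-cons y Y (x ∷ X) with R? x y
  ... | yes _ = cong suc (trans (cong (count (R? x) Y +_) (sum-count-cons y Y X)) (+-exchange (count (R? x) Y) (count (λ x → R? x y) X) _))
  ... | no _  = trans (cong (count (R? x) Y +_) (sum-count-cons y Y X)) (+-exchange (count (R? x) Y) (count (λ x → R? x y) X) _)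

  double-count : ∀ X Y →
    sum (map (λ y → count (λ x → R? x y) X) Y) ≡ sum (map (λ x → count (R? x) Y) X)
  double-count X [] = sym (trans (sum-const _ X (λ _ → refl)) (*-zeroʳ (length X)))
  double-count X (y ∷ Y) = trans (cong (count (λ x → R? x y) X +_) (double-count X Y))
                                 (sym (sum-count-cons y Y X))

module _ {a} {A : Set a} where

  two-distinct : (xs : List A) → Unique xs → 2 ≤ length xs → ∃₂ λ x y → x ∈ xs × y ∈ xs × x ≢ y
  two-distinct (x ∷ y ∷ _) ((x≢y ∷ _) ∷ _) _ = x , y , here refl , there (here refl) , x≢y
  two-distinct (_ ∷ []) _ (s≤s ())

  length≡1⇒equal : {xs : List A} {x y : A} → length xs ≡ 1 → x ∈ xs → y ∈ xs → x ≡ y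
  length≡1⇒equal {_ ∷ []} _ (here refl) (here refl) = refl

  length≡1⇒member : {xs : List A} → length xs ≡ 1 → Σ A (_∈ xs)
  length≡1⇒member {x ∷ _} _ = x , here refl

count-tabulate-cong : ∀ {a b p q} {A : Set a} {B : Set b} {P : Pred A p} {Q : Pred B q}
  (P? : Decidable P) (Q? : Decidable Q) {n : ℕ} (f : Fin n → A) (g : Fin n → B) →
  (∀ i → does (P? (f i)) ≡ does (Q? (g i))) → count P? (tabulate f) ≡ count Q? (tabulate g)
count-tabulate-cong P? Q? {zero} f g same = refl
count-tabulate-cong P? Q? {suc n} f g same
  with does (P? (f zero)) | does (Q? (g zero)) | same zero
... | true  | true  | refl = cong suc (count-tabulate-cong P? Q? (f ∘ suc) (g ∘ suc) (same ∘ suc))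
... | false | false | refl = count-tabulate-cong P? Q? (f ∘ suc) (g ∘ suc) (same ∘ suc)

count-∈ : ∀ {n} (p : Subset n) → count (_∈? p) (allFin n) ≡ ∣ p ∣
count-∈ Vec.[] = refl
count-∈ (inside Vec.∷ p) =
  cong suc (trans (count-tabulate-cong (_∈? inside Vec.∷ p) (_∈? p) suc (λ i → i) (λ _ → refl)) (count-∈ p))
count-∈ (outside Vec.∷ p) =
  trans (count-tabulate-cong (_∈? outside Vec.∷ p) (_∈? p) suc (λ i → i) (λ _ → refl)) (count-∈ p)

count-≡ : ∀ {n} (x : Fin n) → count (Fin._≟ x) (allFin n) ≡ 1
count-≡ {n} x = begin
  count (Fin._≟ x) (allFin n)    ≡⟨ cong length (filter-≐ _ (_∈? ⁅ x ⁆) ((λ { refl → x∈⁅x⁆ x }) , x∈⁅y⁆⇒x≡y x) (allFin n)) ⟩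
  count (_∈? ⁅ x ⁆) (allFin n)   ≡⟨ count-∈ ⁅ x ⁆ ⟩
  ∣ ⁅ x ⁆ ∣                       ≡⟨ ∣⁅x⁆∣≡1 x ⟩
  1                              ∎
  where
  open ≡-Reasoning

cancel-one-copy : ∀ L k c → L * k ≤ L + c → L * (k ∸ 1) ≤ c
cancel-one-copy L zero c _ = ≤-trans (≤-reflexive (*-zeroʳ L)) z≤n
cancel-one-copy L (suc k) c Lk≤L+c = +-cancelˡ-≤ L _ _ (≤-trans (≤-reflexive (sym (*-suc L k))) Lk≤L+c)

pointsOf : ∀ {v} → Subset v → List (Fin v)
pointsOf {v} W = filter (_∈? W) (allFin v)

length-pointsOf : ∀ {v} (W : Subset v) → length (pointsOf W) ≡ ∣ W ∣
length-pointsOf W = count-∈ W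

count-pointsOf-≡ : ∀ {v} {W : Subset v} {x} → x ∈ₛ W → count (Fin._≟ x) (pointsOf W) ≡ 1
count-pointsOf-≡ {v} {W} {x} x∈W =
  trans (count-within (Fin._≟ x) (_∈? W) (λ { refl → x∈W }) (allFin v)) (count-≡ x)

count-pointsOf-≢ : ∀ {v} {W : Subset v} {x} → x ∈ₛ W → count (∁? (Fin._≟ x)) (pointsOf W) ≡ ∣ W ∣ ∸ 1
count-pointsOf-≢ {W = W} {x} x∈W = begin
  others                                          ≡⟨ sym (m+n∸m≡n 1 others) ⟩
  1 + others ∸ 1                                  ≡⟨ cong (λ c → c + others ∸ 1) (sym (count-pointsOf-≡ x∈W)) ⟩
  count (Fin._≟ x) (pointsOf W) + others ∸ 1      ≡⟨ cong (_∸ 1) (count-partition (Fin._≟ x) (pointsOf W)) ⟩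
  length (pointsOf W) ∸ 1                         ≡⟨ cong (_∸ 1) (length-pointsOf W) ⟩
  ∣ W ∣ ∸ 1                                       ∎
  where
  open ≡-Reasoning
  others : ℕ
  others = count (∁? (Fin._≟ x)) (pointsOf W)

module Packing {v k : ℕ} (W : Subset v) (N : List (Subset v))
  (meets : ∀ {B} → B ∈ N → count (_∈? B) (pointsOf W) ≡ k)
  (packing : ∀ x y → x ≢ y → pairCount N x y ≤ 1) where

  degree : Fin v → ℕ
  degree x = count (x ∈?_) N

  incidences : ∀ {M} → (∀ {B} → B ∈ M → B ∈ N) →
    sum (map (λ B → count (_∈? B) (pointsOf W)) M) ≡ length M * k
  incidences M⊆N = sum-const _ _ (meets ∘ M⊆N)

  -- Through x ∈ W there are at most (|W| − 1)/(k − 1) blocks: the blocks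
  -- through x meet W∖{x} in k − 1 points each, and these are disjoint.
  degree-bound : ∀ {x} → x ∈ₛ W → degree x * (k ∸ 1) ≤ ∣ W ∣ ∸ 1
  degree-bound {x} x∈W = cancel-one-copy (degree x) k (∣ W ∣ ∸ 1) (begin
    degree x * k                                             ≡⟨ incidences through⊆N ⟨
    sum (map (λ B → count (_∈? B) (pointsOf W)) through)     ≡⟨ double-count _∈?_ (pointsOf W) through ⟩
    sum (map (λ y → count (y ∈?_) through) (pointsOf W))     ≤⟨ sum-peak-bound Fin._≟_ _ x (length-filter (x ∈?_) through) meet≤1 (pointsOf W) ⟩
    count (Fin._≟ x) (pointsOf W) * degree x
      + count (∁? (Fin._≟ x)) (pointsOf W)                   ≡⟨ cong₂ _+_ (cong (_* degree x) (count-pointsOf-≡ x∈W)) (count-pointsOf-≢ x∈W) ⟩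
    degree x + 0 + (∣ W ∣ ∸ 1)                                ≡⟨ cong (_+ (∣ W ∣ ∸ 1)) (+-identityʳ (degree x)) ⟩
    degree x + (∣ W ∣ ∸ 1)                                    ∎)
    where
    open ≤-Reasoning
    through : List (Subset v)
    through = filter (x ∈?_) N
    through⊆N : ∀ {B} → B ∈ through → B ∈ N
    through⊆N = proj₁ ∘ ∈-filter⁻ (x ∈?_)
    meet≤1 : ∀ {y} → y ≢ x → count (y ∈?_) through ≤ 1
    meet≤1 {y} y≢x = begin
      count (y ∈?_) through  ≡⟨ cong length (filter-filter (x ∈?_) (y ∈?_) N) ⟩
      pairCount N x y        ≤⟨ packing x y (y≢x ∘ sym) ⟩
      1                      ∎

  -- Double counting incidences between N and W, each point of W lying in at
  -- most (|W| − 1)/(k − 1) blocks.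
  packing-bound : length N * k * (k ∸ 1) ≤ ∣ W ∣ * (∣ W ∣ ∸ 1)
  packing-bound = begin
    length N * k * (k ∸ 1)                               ≡⟨ cong (_* (k ∸ 1)) (sym (incidences (λ B∈N → B∈N))) ⟩
    sum (map (λ B → count (_∈? B) (pointsOf W)) N) * (k ∸ 1) ≡⟨ cong (_* (k ∸ 1)) (double-count _∈?_ (pointsOf W) N) ⟩
    sum (map degree (pointsOf W)) * (k ∸ 1)              ≤⟨ sum-bound degree (k ∸ 1) (∣ W ∣ ∸ 1) (pointsOf W) degree-bound′ ⟩
    length (pointsOf W) * (∣ W ∣ ∸ 1)                    ≡⟨ cong (_* (∣ W ∣ ∸ 1)) (length-pointsOf W) ⟩
    ∣ W ∣ * (∣ W ∣ ∸ 1)                                  ∎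
    where
    open ≤-Reasoning
    degree-bound′ : ∀ {x} → x ∈ pointsOf W → degree x * (k ∸ 1) ≤ ∣ W ∣ ∸ 1
    degree-bound′ = degree-bound ∘ proj₂ ∘ ∈-filter⁻ (_∈? W) {xs = allFin v}

module IntegerEmbedding where

  open import Data.Integer using (+_)

  fromℤ : ℤ → ℚ
  fromℤ z = mkℚ z 0 (coprime-sym (1-coprimeTo ℤ.∣ z ∣))

  fromℤ-+ : ∀ a b → fromℤ a +ℚ fromℤ b ≡ fromℤ (a ℤ.+ b)
  fromℤ-+ a b = toℚᵘ-injective (ℚᵘ.≃-trans (toℚᵘ-homo-+ (fromℤ a) (fromℤ b)) (ℚᵘ.*≡* (cross a b)))
    where
    -- the cross-multiplied form of a/1 + b/1 = (a + b)/1
    cross : ∀ a b → (a ℤ.* + 1 ℤ.+ b ℤ.* + 1) ℤ.* + 1 ≡ (a ℤ.+ b) ℤ.* (+ 1 ℤ.* + 1)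
    cross = solve-∀

  fromℤ-nonneg : ∀ z → 0ℚ ≤ℚ fromℤ z → + 0 ℤ.≤ z
  fromℤ-nonneg z (ℚ.*≤* 0≤z*1) = ℤ.≤-trans 0≤z*1 (ℤ.≤-reflexive (ℤ.*-identityʳ z))

module TestFunction {v : ℕ} (W : Subset v) (w : ℕ) where

  open import Data.Integer using (+_; -_; _-_) renaming (_+_ to _+ℤ_)
  open IntegerEmbedding

  weight : Fin v → ℤ
  weight x with x ∈? W
  ... | yes _ = + v - + w
  ... | no _  = - + w

  f : Fin v → ℚ
  f = fromℤ ∘ weight

  sumℤ : List ℤ → ℤ
  sumℤ = foldr _+ℤ_ (+ 0)

  regroup : ∀ a b c d → (a - b) +ℤ (c - d) ≡ (a +ℤ c) - (b +ℤ d)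
  regroup = solve-∀

  regroup-neg : ∀ b c d → - b +ℤ (c - d) ≡ c - (b +ℤ d)
  regroup-neg = solve-∀

  weight-sum : ∀ xs → sumℤ (map weight xs) ≡ + (count (_∈? W) xs * v) - + (length xs * w)
  weight-sum [] = refl
  weight-sum (x ∷ xs) with x ∈? W
  ... | yes _ = begin
    (+ v - + w) +ℤ sumℤ (map weight xs)  ≡⟨ cong ((+ v - + w) +ℤ_) (weight-sum xs) ⟩
    (+ v - + w) +ℤ (+ c - + L)           ≡⟨ regroup (+ v) (+ w) (+ c) (+ L) ⟩
    (+ v +ℤ + c) - (+ w +ℤ + L)          ≡⟨ cong₂ _-_ (ℤ.pos-+ v c) (ℤ.pos-+ w L) ⟨
    + (v + c) - + (w + L)                ∎
    where
    open ≡-Reasoning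
    c L : ℕ
    c = count (_∈? W) xs * v
    L = length xs * w
  ... | no _ = begin
    - + w +ℤ sumℤ (map weight xs)        ≡⟨ cong (- + w +ℤ_) (weight-sum xs) ⟩
    - + w +ℤ (+ c - + L)                 ≡⟨ regroup-neg (+ w) (+ c) (+ L) ⟩
    + c - (+ w +ℤ + L)                   ≡⟨ cong (_-_ (+ c)) (ℤ.pos-+ w L) ⟨
    + c - + (w + L)                      ∎
    where
    open ≡-Reasoning
    c L : ℕ
    c = count (_∈? W) xs * v
    L = length xs * w

  f-sum : ∀ xs → sumℚ (map f xs) ≡ fromℤ (sumℤ (map weight xs))
  f-sum [] = refl
  f-sum (x ∷ xs) = trans (cong (f x +ℚ_) (f-sum xs)) (fromℤ-+ (weight x) _)

  total-zero : ∣ W ∣ ≡ w → totalSum f ≡ 0ℚ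
  total-zero ∣W∣≡w = begin
    totalSum f                                                  ≡⟨ f-sum (allFin v) ⟩
    fromℤ (sumℤ (map weight (allFin v)))                        ≡⟨ cong fromℤ (weight-sum (allFin v)) ⟩
    fromℤ (+ (length (pointsOf W) * v) - + (length (allFin v) * w))
                                                                ≡⟨ cong₂ (λ a b → fromℤ (+ (a * v) - + (b * w))) (trans (length-pointsOf W) ∣W∣≡w) (length-tabulate {n = v} (λ i → i)) ⟩
    fromℤ (+ (w * v) - + (v * w))                               ≡⟨ cong (λ t → fromℤ (+ t - + (v * w))) (*-comm w v) ⟩
    fromℤ (+ (v * w) - + (v * w))                               ≡⟨ cong fromℤ (ℤ.+-inverseʳ (+ (v * w))) ⟩
    0ℚ                                                          ∎
    where open ≡-Reasoning

  nonneg-block : ∀ B → 0ℚ ≤ℚ blockSum f B → ∣ B ∣ * w ≤ count (_∈? W) (pointsOf B) * v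
  nonneg-block B 0≤sum =
    subst (λ b → b * w ≤ count (_∈? W) (pointsOf B) * v) (count-∈ B) (ℤ.drop‿+≤+ (ℤ.0≤i-j⇒j≤i 0≤weights))
    where
    0≤weights : + 0 ℤ.≤ + (count (_∈? W) (pointsOf B) * v) - + (length (pointsOf B) * w)
    0≤weights = subst (+ 0 ℤ.≤_) (weight-sum (pointsOf B))
                      (fromℤ-nonneg _ (subst (0ℚ ≤ℚ_) (f-sum (pointsOf B)) 0≤sum))

multiple-exceeds⇒≥2 : ∀ {v} a → v < a * v → 2 ≤ a
multiple-exceeds⇒≥2 zero v<0 = ⊥-elim (n≮0 v<0)
multiple-exceeds⇒≥2 {v} (suc zero) v<v+0 = ⊥-elim (<-irrefl (sym (+-identityʳ v)) v<v+0)
multiple-exceeds⇒≥2 (suc (suc a)) _ = s≤s (s≤s z≤n)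

two-common-points : ∀ {v} (W B : Subset v) → 2 ≤ count (_∈? W) (pointsOf B) →
  ∃₂ λ x y → x ≢ y × (x ∈ₛ B × x ∈ₛ W) × (y ∈ₛ B × y ∈ₛ W)
two-common-points {v} W B 2≤common
  with two-distinct (filter (_∈? W) (pointsOf B)) unique 2≤common
  where
  unique : Unique (filter (_∈? W) (pointsOf B))
  unique = Unique.filter⁺ (_∈? W) (Unique.filter⁺ (_∈? B) (Unique.allFin⁺ v))
... | x , y , x∈ , y∈ , x≢y = x , y , x≢y , common x∈ , common y∈
  where
  common : ∀ {z} → z ∈ filter (_∈? W) (pointsOf B) → z ∈ₛ B × z ∈ₛ W
  common z∈ with ∈-filter⁻ (_∈? W) {xs = pointsOf B} z∈
  ... | z∈B , z∈W = proj₂ (∈-filter⁻ (_∈? B) {xs = allFin v} z∈B) , z∈W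

both? : ∀ {v} (x y : Fin v) → Decidable (λ B → x ∈ₛ B × y ∈ₛ B)
both? x y B = (x ∈? B) ×-dec (y ∈? B)

pairCount-mono : ∀ {v} {Bs' Bs : List (Subset v)} → Bs' ⊑ Bs → ∀ x y → pairCount Bs' x y ≤ pairCount Bs x y
pairCount-mono Bs'⊑Bs x y = length-mono-≤ (filter⁺ (both? x y) (both? x y) (λ { refl p → p }) Bs'⊑Bs)

-- In a design, a block through two distinct points of a subdesign on W is the
-- subdesign block through them, hence lies inside W.
block-in-subdesign : ∀ {v} {Bs Bs' : List (Subset v)} {W : Subset v} →
  (∀ x y → x ≢ y → pairCount Bs x y ≡ 1) → Bs' ⊑ Bs → All (_⊆ₛ W) Bs' →
  (∀ x y → x ∈ₛ W → y ∈ₛ W → x ≢ y → pairCount Bs' x y ≡ 1) →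
  ∀ {B x y} → B ∈ Bs → x ≢ y → x ∈ₛ B × x ∈ₛ W → y ∈ₛ B × y ∈ₛ W → B ⊆ₛ W
block-in-subdesign {Bs' = Bs'} {W} pairs Bs'⊑Bs inW pairs' {B} {x} {y} B∈Bs x≢y (x∈B , x∈W) (y∈B , y∈W)
  with length≡1⇒member (pairs' x y x∈W y∈W x≢y)
... | C , C∈through with ∈-filter⁻ (both? x y) {xs = Bs'} C∈through
...   | C∈Bs' , xy∈C = subst (_⊆ₛ W) (sym B≡C) (All.lookup inW C∈Bs')
  where
  B≡C : B ≡ C
  B≡C = length≡1⇒equal (pairs x y x≢y) (∈-filter⁺ (both? x y) B∈Bs (x∈B , y∈B))
                                       (∈-filter⁺ (both? x y) (Any-resp-⊆ Bs'⊑Bs C∈Bs') xy∈C)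

module NonnegativeBlocks {v k w : ℕ} {Bs Bs' : List (Subset v)} {W : Subset v}
  (sizes : All (λ B → ∣ B ∣ ≡ k) Bs)
  (pairs : ∀ x y → x ≢ y → pairCount Bs x y ≡ 1)
  (Bs'⊑Bs : Bs' ⊑ Bs) (inW : All (_⊆ₛ W) Bs')
  (pairs' : ∀ x y → x ∈ₛ W → y ∈ₛ W → x ≢ y → pairCount Bs' x y ≡ 1)
  (v<kw : v < k * w) where

  open TestFunction W w public using (f)
  open TestFunction W w using (nonneg-block)

  nonneg? : Decidable (λ B → 0ℚ ≤ℚ blockSum f B)
  nonneg? B = 0ℚ ≤ℚ? blockSum f B

  N : List (Subset v)
  N = filter nonneg? Bs

  -- A non-negative block B satisfies k·w ≤ |B ∩ W|·v, so with v < k·w it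
  -- meets W twice and therefore lies in W.
  lies-in-W : ∀ {B} → B ∈ N → B ⊆ₛ W
  lies-in-W {B} B∈N with ∈-filter⁻ nonneg? {xs = Bs} B∈N
  ... | B∈Bs , 0≤sum with two-common-points W B (multiple-exceeds⇒≥2 _ v<common·v)
    where
    v<common·v : v < count (_∈? W) (pointsOf B) * v
    v<common·v = <-≤-trans v<kw (≤-trans (≤-reflexive (cong (_* w) (sym (All.lookup sizes B∈Bs))))
                                         (nonneg-block B 0≤sum))
  ...   | x , y , x≢y , x∈ , y∈ = block-in-subdesign pairs Bs'⊑Bs inW pairs' B∈Bs x≢y x∈ y∈

  meets : ∀ {B} → B ∈ N → count (_∈? B) (pointsOf W) ≡ k
  meets {B} B∈N = begin
    count (_∈? B) (pointsOf W)    ≡⟨ count-within (_∈? B) (_∈? W) (lies-in-W B∈N) (allFin v) ⟩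
    count (_∈? B) (allFin v)      ≡⟨ count-∈ B ⟩
    ∣ B ∣                          ≡⟨ All.lookup sizes (proj₁ (∈-filter⁻ nonneg? {xs = Bs} B∈N)) ⟩
    k                             ∎
    where open ≡-Reasoning

  packing : ∀ x y → x ≢ y → pairCount N x y ≤ 1
  packing x y x≢y = ≤-trans (pairCount-mono (filter-⊆ nonneg? Bs) x y) (≤-reflexive (pairs x y x≢y))

  open Packing W N meets packing public using (packing-bound)

theorem3 : (v k w : ℕ) (Bs : List (Subset v)) → 2 ≤ k →
    IsDesign v k Bs → HasSubdesign v k w Bs →
    v < k * w → w * w ∸ w < k * (v ∸ 1) →
    ¬ MMSStar v k Bs
theorem3 v k w Bs _ (sizes , pairs) (W , ∣W∣≡w , Bs' , Bs'⊑Bs , inW , _ , pairs') v<kw small mms =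
  <⇒≱ small (begin
    k * (v ∸ 1)                   ≤⟨ *-monoʳ-≤ k (mms f (TestFunction.total-zero W w ∣W∣≡w)) ⟩
    k * (length N * (k ∸ 1))      ≡⟨ sym (*-assoc k (length N) (k ∸ 1)) ⟩
    k * length N * (k ∸ 1)        ≡⟨ cong (_* (k ∸ 1)) (*-comm k (length N)) ⟩
    length N * k * (k ∸ 1)        ≤⟨ packing-bound ⟩
    ∣ W ∣ * (∣ W ∣ ∸ 1)            ≡⟨ cong (λ n → n * (n ∸ 1)) ∣W∣≡w ⟩
    w * (w ∸ 1)                   ≡⟨ *-distribˡ-∸ w w 1 ⟩
    w * w ∸ w * 1                 ≡⟨ cong (w * w ∸_) (*-identityʳ w) ⟩
    w * w ∸ w                     ∎)
  where
  open NonnegativeBlocks sizes pairs Bs'⊑Bs inW pairs' v<kw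
  open ≤-Reasoning
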